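{- Let $\mathcal L$ be a logic and $\tau(x,\vec y)$ a parametrized equational translation. Then $\tau$ almost defines truth in $\mathrm{Mod}^{*}\mathcal L$ if and only if $\tau$ almost defines truth in $\mathrm{LMod}^{*}\mathcal L$.
   Context: Fix an algebraic type and a countably infinite set of variables; $Fm$ is the set of formulas, $\mathbf{Fm}$ the formula algebra. A logic $\mathcal L$ is a structural closure operator $C_{\mathcal L}$ on $\mathcal P(Fm)$; $\Gamma\vdash_{\mathcal L}\varphi$ means $\varphi\in C_{\mathcal L}(\Gamma)$. A deductive filter of $\mathcal L$ over an algebra $\mathbf A$ is $F\subseteq A$ such that whenever $\Gamma\vdash_{\mathcal L}\varphi$ and $h\colon\mathbf{Fm}\to\mathbf A$ is a homomorphism with $h[\Gamma]\subseteq F$, then $h(\varphi)\in F$; $\mathcal{F}i_{\mathcal L}\mathbf A$ is the set of these and $\mathrm{Th}\mathcal L=\mathcal{F}i_{\mathcal L}\mathbf{Fm}$. The Leibniz congruence $\Omega^{\mathbf A}F$ is the largest congruence of $\mathbf A$ compatible with $F$; $\Omega=\Omega^{\mathbf{Fm}}$. $\mathrm{Mod}^{*}\mathcal L:=\{\langle\mathbf A,F\rangle: F\in\mathcal{F}i_{\mathcal L}\mathbf A,\ \Omega^{\mathbf A}F=\mathrm{Id}_{\mathbf A}\}$ and $\mathrm{LMod}^{*}\mathcal L:=\{\langle\mathbf{Fm}/\Omega\Gamma,\Gamma/\Omega\Gamma\rangle:\Gamma\in\mathrm{Th}\mathcal L\}$. A parametrized equational translation is a set $\tau(x,\vec y)$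 of equations in a distinguished variable $x$ and parameters $\vec y$; for an algebra $\mathbf A$, $\tau(\mathbf A):=\{a\in A:\mathbf A\models\tau(a,\vec c)\text{ for all assignments }\vec c\text{ in }A\text{ to the parameters}\}$. $\tau$ almost defines truth in a class $\mathsf M$ of matrices if $\tau(\mathbf A)=F$ for every $\langle\mathbf A,F\rangle\in\mathsf M$ with $F\neq\emptyset$. -}

module Defs where

open import Level using (Level; 0ℓ; _⊔_) renaming (suc to lsuc)
open import Data.Nat using (ℕ; zero; suc)
open import Data.Vec using (Vec; []; _∷_; map)
open import Data.Vec.Relation.Binary.Pointwise.Inductive using (Pointwise)
open import Data.Product using (Σ; _×_; _,_; ∃)
open import Relation.Binary using (Rel; IsEquivalence)
open import Relation.Binary.PropositionalEquality using (_≡_)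
open import Relation.Unary using (Pred; _⊆_)

record Signature : Set₁ where
  field
    Op : Set
    ar : Op → ℕ

module AAL (sig : Signature) where
  open Signature sig

  data Fm : Set where
    var : ℕ → Fm
    op  : (o : Op) → Vec Fm (ar o) → Fm

  -- Algebras are represented as setoids (carrier + equality) with operations;
  -- "=" in the algebra is _≈_ (this lets us represent quotients like Fm/ΩΓ).
  record RawAlgebra (a ℓ : Level) : Set (lsuc (a ⊔ ℓ)) where
    field
      Carrier : Set a
      _≈_     : Rel Carrier ℓ
      ⟦_⟧     : (o : Op) → Vec Carrier (ar o) → Carrier

  record IsAlgebra {a ℓ : Level} (A : RawAlgebra a ℓ) : Set (a ⊔ ℓ) where
    open RawAlgebra A
    field
      isEquivalence : IsEquivalence _≈_
      ⟦⟧-cong : ∀ o {xs ys} → Pointwise _≈_ xs ys → ⟦ o ⟧ xs ≈ ⟦ o ⟧ ys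

  module _ {a ℓ : Level} (A : RawAlgebra a ℓ) where
    open RawAlgebra A
    mutual
      eval : (ℕ → Carrier) → Fm → Carrier
      eval v (var n)   = v n
      eval v (op o ts) = ⟦ o ⟧ (evals v ts)

      evals : ∀ {n} → (ℕ → Carrier) → Vec Fm n → Vec Carrier n
      evals v []       = []
      evals v (t ∷ ts) = eval v t ∷ evals v ts

    IsHom : (Fm → Carrier) → Set ℓ
    IsHom h = ∀ o (ts : Vec Fm (ar o)) → h (op o ts) ≈ ⟦ o ⟧ (map h ts)

    -- congruences of A (in the setoid representation they contain ≈)
    record IsCongruence (θ : Rel Carrier ℓ) : Set (a ⊔ ℓ) where
      field
        isEquivalence : IsEquivalence θ
        ≈⊆θ : ∀ {x y} → x ≈ y → θ x y
        compat : ∀ o {xs ys} → Pointwise θ xs ys → θ (⟦ o ⟧ xs) (⟦ o ⟧ ys)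

    Compatible : ∀ {f} → Rel Carrier ℓ → Pred Carrier f → Set (a ⊔ ℓ ⊔ f)
    Compatible θ F = ∀ {x y} → θ x y → F x → F y

    -- Leibniz congruence Ω^A F: the largest congruence compatible with F,
    -- i.e. the union of all congruences compatible with F.
    Leibniz : ∀ {f} → Pred Carrier f → Rel Carrier (a ⊔ lsuc ℓ ⊔ f)
    Leibniz F x y = Σ (Rel Carrier ℓ) λ θ → IsCongruence θ × Compatible θ F × θ x y

    Reduced : ∀ {f} → Pred Carrier f → Set (a ⊔ lsuc ℓ ⊔ f)
    Reduced F = ∀ {x y} → Leibniz F x y → x ≈ y

  FmAlg : RawAlgebra 0ℓ 0ℓ
  FmAlg = record { Carrier = Fm ; _≈_ = _≡_ ; ⟦_⟧ = op }

  subst : (ℕ → Fm) → Fm → Fm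
  subst = eval FmAlg

  _[_] : (ℕ → Fm) → Pred Fm 0ℓ → Pred Fm 0ℓ
  (σ [ Γ ]) ψ = ∃ λ χ → Γ χ × subst σ χ ≡ ψ

  record Logic : Set₁ where
    field
      C : Pred Fm 0ℓ → Pred Fm 0ℓ
      extensive  : ∀ Γ → Γ ⊆ C Γ
      monotone   : ∀ {Γ Δ} → Γ ⊆ Δ → C Γ ⊆ C Δ
      idempotent : ∀ Γ → C (C Γ) ⊆ C Γ
      structural : ∀ σ Γ → ∀ {φ} → C Γ φ → C (σ [ Γ ]) (subst σ φ)

    _⊢_ : Pred Fm 0ℓ → Fm → Set
    Γ ⊢ φ = C Γ φ

  IsFilter : ∀ {a ℓ f} → Logic → (A : RawAlgebra a ℓ) → Pred (RawAlgebra.Carrier A) f → Set (lsuc 0ℓ ⊔ a ⊔ ℓ ⊔ f)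
  IsFilter L A F = ∀ (Γ : Pred Fm 0ℓ) φ → Γ ⊢ φ → ∀ h → IsHom A h → (∀ ψ → Γ ψ → F (h ψ)) → F (h φ)
    where open Logic L

  IsTheory : Logic → Pred Fm 0ℓ → Set₁
  IsTheory L Γ = IsFilter L FmAlg Γ

  -- A parametrized equational translation τ(x, y⃗): a set of equations
  -- (pairs of formulas); variable 0 is x, all other variables are parameters.
  Translation : Set₁
  Translation = Pred (Fm × Fm) 0ℓ

  _∷ₐ_ : ∀ {a} {A : Set a} → A → (ℕ → A) → ℕ → A
  (x ∷ₐ c) zero    = x
  (x ∷ₐ c) (suc n) = c n

  τ⟨_⟩ : ∀ {a ℓ} → Translation → (A : RawAlgebra a ℓ) → Pred (RawAlgebra.Carrier A) (a ⊔ ℓ)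
  τ⟨ τ ⟩ A x = ∀ (c : ℕ → Carrier) (s t : Fm) → τ (s , t) → eval A (x ∷ₐ c) s ≈ eval A (x ∷ₐ c) t
    where open RawAlgebra A

  SameSet : ∀ {a f g} {A : Set a} → Pred A f → Pred A g → Set (a ⊔ f ⊔ g)
  SameSet F G = ∀ x → (F x → G x) × (G x → F x)

  Respects≈ : ∀ {a ℓ f} (A : RawAlgebra a ℓ) → Pred (RawAlgebra.Carrier A) f → Set (a ⊔ ℓ ⊔ f)
  Respects≈ A F = ∀ {x y} → x ≈ y → F x → F y
    where open RawAlgebra A

  AlmostDefinesMod* : Logic → Translation → Set₁
  AlmostDefinesMod* L τ =
    ∀ (A : RawAlgebra 0ℓ 0ℓ) → IsAlgebra A →
    ∀ (F : Pred (RawAlgebra.Carrier A) 0ℓ) → Respects≈ A F →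
    IsFilter L A F → Reduced A F →
    Σ (RawAlgebra.Carrier A) F →
    SameSet (τ⟨ τ ⟩ A) F

  -- 𝐅𝐦/ΩΓ, represented as the setoid algebra on Fm with equality ΩΓ
  FmQuot : Pred Fm 0ℓ → RawAlgebra 0ℓ (lsuc 0ℓ)
  FmQuot Γ = record { Carrier = Fm ; _≈_ = Leibniz FmAlg Γ ; ⟦_⟧ = op }

  -- τ almost defines truth in LMod* L = {⟨𝐅𝐦/ΩΓ, Γ/ΩΓ⟩ : Γ ∈ Th L}
  AlmostDefinesLMod* : Logic → Translation → Set₁
  AlmostDefinesLMod* L τ =
    ∀ (Γ : Pred Fm 0ℓ) → IsTheory L Γ →
    Σ Fm Γ →
    SameSet (τ⟨ τ ⟩ (FmQuot Γ)) Γ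

module Submission where

-- Both directions rest on the description of the Leibniz congruence by unary
-- polynomials: a Ω^A F b iff δ(a, c⃗) ∈ F ⇔ δ(b, c⃗) ∈ F for every formula
-- δ(x, z⃗) and all parameters c⃗ in A.
--
-- Mod* ⇒ LMod*: for a theory Γ, the matrix ⟨𝐅𝐦/ΩΓ, Γ⟩ is itself a reduced
-- model of L, so τ(𝐅𝐦/ΩΓ) = Γ.
--
-- LMod* ⇒ Mod*: let ⟨𝐀, F⟩ be a reduced model and w an assignment with
-- w(x) = a. The preimage Γ_w of F under evaluation by w is a theory. If
-- a ∈ τ(𝐀), then x ∈ τ(𝐅𝐦/ΩΓ_w), since the kernel of w is a congruence
-- compatible with Γ_w; so a = w(x) ∈ F. If a ∈ F, then x ∈ Γ_w, so
-- x ∈ τ(𝐅𝐦/ΩΓ_w); for an equation s ≈ t of τ this makes s(x, c⃗) and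
-- t(x, c⃗) Leibniz congruent modulo Γ_w, hence s(a, c⃗) and t(a, c⃗)
-- indiscernible by every unary polynomial, hence equal as ⟨𝐀, F⟩ is reduced.
-- Choosing w so that it covers both the parameters of τ and those of the
-- polynomial is where even and odd variables come in.

open import Data.Fin as Fin using (Fin; toℕ)
open import Data.Nat using (ℕ; zero; suc)
open import Data.Product using (Σ; _,_; proj₁; proj₂)
open import Data.Vec using (Vec; []; _∷_; map; tabulate; lookup; _[_]≔_)
open import Data.Vec.Properties using (map-∘; map-[]≔; tabulate-∘; tabulate-cong; tabulate∘lookup)
open import Data.Vec.Relation.Binary.Pointwise.Inductive as Pointwise using (Pointwise; []; _∷_; Pointwise-≡⇒≡)
open import Function using (_∘_; id; const; _on_)
open import Function.Bundles using (_⇔_; mk⇔; Equivalence)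
open import Function.Properties.Equivalence using (⇔-isEquivalence)
open import Level using (Level; 0ℓ; _⊔_)
open import Relation.Binary using (Rel; IsEquivalence; Reflexive; Symmetric; Transitive; _⇒_)
open import Relation.Binary.Construct.On as On using ()
open import Relation.Binary.PropositionalEquality as ≡ using (_≡_; refl; cong; sym; trans; subst₂)
open import Relation.Unary using (Pred; _⊆_)
open import Defs

private
  variable
    a b r s : Level
    A : Set a
    B : Set b

double : ℕ → ℕ
double zero    = zero
double (suc k) = suc (suc (double k))

interleave : (ℕ → A) → (ℕ → A) → ℕ → A
interleave f g zero    = f zero
interleave f g (suc n) = interleave g (f ∘ suc) n

interleave-double : (f g : ℕ → A) (k : ℕ) → interleave f g (double k) ≡ f k
interleave-double f g zero    = refl
interleave-double f g (suc k) = interleave-double (f ∘ suc) (g ∘ suc) k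

interleave-suc-double : (f g : ℕ → A) (k : ℕ) → interleave f g (suc (double k)) ≡ g k
interleave-suc-double f g = interleave-double g (f ∘ suc)

infixr 5 _++ₐ_

_++ₐ_ : ∀ {n} → Vec A n → (ℕ → A) → ℕ → A
([]       ++ₐ f) k       = f k
((x ∷ xs) ++ₐ f) zero    = x
((x ∷ xs) ++ₐ f) (suc k) = (xs ++ₐ f) k

++ₐ-toℕ : ∀ {n} (xs : Vec A n) (f : ℕ → A) (i : Fin n) → (xs ++ₐ f) (toℕ i) ≡ lookup xs i
++ₐ-toℕ (x ∷ xs) f Fin.zero    = refl
++ₐ-toℕ (x ∷ xs) f (Fin.suc i) = ++ₐ-toℕ xs f i

coordinatewise : ∀ {n} {R : Rel A r} {S : Rel B s} → Reflexive S → Transitive S →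
  (G : Vec A n → B) → (∀ zs i {u v} → R u v → S (G (zs [ i ]≔ u)) (G (zs [ i ]≔ v))) →
  ∀ {xs ys} → Pointwise R xs ys → S (G xs) (G ys)
coordinatewise S-refl S-trans G step [] = S-refl
coordinatewise {S = S} S-refl S-trans G step {x ∷ xs} {y ∷ ys} (xRy ∷ xsRys) =
  S-trans (step (x ∷ xs) Fin.zero xRy)
          (coordinatewise {S = S} S-refl S-trans (λ zs → G (y ∷ zs)) (λ zs i → step (y ∷ zs) (Fin.suc i)) xsRys)

module AlmostDefinability (sig : Signature) where
  open Signature sig
  open AAL sig

  module _ {a ℓ} (A : RawAlgebra a ℓ) where
    open RawAlgebra A

    OpCompatible : Rel Carrier r → Set (a ⊔ r)
    OpCompatible R = ∀ o {xs ys} → Pointwise R xs ys → R (⟦ o ⟧ xs) (⟦ o ⟧ ys)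

    mutual
      eval-preserves : {R : Rel Carrier r} → OpCompatible R →
        ∀ {v v'} → (∀ n → R (v n) (v' n)) → ∀ φ → R (eval A v φ) (eval A v' φ)
      eval-preserves R-compat vRv' (var n)   = vRv' n
      eval-preserves R-compat vRv' (op o ts) = R-compat o (evals-preserves R-compat vRv' ts)

      evals-preserves : {R : Rel Carrier r} → OpCompatible R →
        ∀ {v v'} → (∀ n → R (v n) (v' n)) → ∀ {n} (ts : Vec Fm n) →
        Pointwise R (evals A v ts) (evals A v' ts)
      evals-preserves R-compat vRv' []       = []
      evals-preserves R-compat vRv' (t ∷ ts) = eval-preserves R-compat vRv' t ∷ evals-preserves R-compat vRv' ts

    eval-ext : ∀ {v v'} → (∀ n → v n ≡ v' n) → ∀ φ → eval A v φ ≡ eval A v' φ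
    eval-ext = eval-preserves (λ o → cong ⟦ o ⟧ ∘ Pointwise-≡⇒≡)

    evals≡map : ∀ v {n} (ts : Vec Fm n) → evals A v ts ≡ map (eval A v) ts
    evals≡map v []       = refl
    evals≡map v (t ∷ ts) = cong (eval A v t ∷_) (evals≡map v ts)

    mutual
      eval-subst : ∀ w σ φ → eval A w (subst σ φ) ≡ eval A (eval A w ∘ σ) φ
      eval-subst w σ (var n)   = refl
      eval-subst w σ (op o ts) = cong ⟦ o ⟧ (evals-subst w σ ts)

      evals-subst : ∀ w σ {n} (ts : Vec Fm n) → evals A w (evals FmAlg σ ts) ≡ evals A (eval A w ∘ σ) ts
      evals-subst w σ []       = refl
      evals-subst w σ (t ∷ ts) = ≡.cong₂ _∷_ (eval-subst w σ t) (evals-subst w σ ts)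

    eval-subst-∷ₐ : ∀ {w σ f} p → (∀ k → eval A w (σ k) ≡ f k) →
      ∀ φ → eval A w (subst (p ∷ₐ σ) φ) ≡ eval A (eval A w p ∷ₐ f) φ
    eval-subst-∷ₐ {w} {σ} {f} p σ≗f φ = trans (eval-subst w (p ∷ₐ σ) φ) (eval-ext pointwise φ)
      where
        pointwise : ∀ n → eval A w ((p ∷ₐ σ) n) ≡ (eval A w p ∷ₐ f) n
        pointwise zero    = refl
        pointwise (suc k) = σ≗f k

  evenVar oddVar : ℕ → Fm
  evenVar k = var (suc (double k))
  oddVar  k = var (suc (suc (double k)))

  -- δ(π(x, z⃗), z⃗'), with the parameters z⃗ of π renamed to even and the
  -- parameters z⃗' of δ to odd variables.
  plug : Fm → Fm → Fm
  plug δ π = subst (subst (var 0 ∷ₐ evenVar) π ∷ₐ oddVar) δ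

  eval-plug : ∀ {a ℓ} (A : RawAlgebra a ℓ) x f g δ π →
    eval A (x ∷ₐ interleave f g) (plug δ π) ≡ eval A (eval A (x ∷ₐ f) π ∷ₐ g) δ
  eval-plug A x f g δ π =
    trans (eval-subst-∷ₐ A _ (interleave-suc-double f g) δ)
          (cong (λ y → eval A (y ∷ₐ g) δ) (eval-subst-∷ₐ A (var 0) (interleave-double f g) π))

  FmAlg-isAlgebra : IsAlgebra FmAlg
  FmAlg-isAlgebra = record
    { isEquivalence = ≡.isEquivalence
    ; ⟦⟧-cong       = λ o → cong (op o) ∘ Pointwise-≡⇒≡
    }

  FmWith : ∀ {ℓ} → Rel Fm ℓ → RawAlgebra 0ℓ ℓ
  FmWith R = record { Carrier = Fm ; _≈_ = R ; ⟦_⟧ = op }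

  FmWith-isAlgebra : {R : Rel Fm 0ℓ} → IsCongruence FmAlg R → IsAlgebra (FmWith R)
  FmWith-isAlgebra R-cong = record
    { isEquivalence = IsCongruence.isEquivalence R-cong
    ; ⟦⟧-cong       = IsCongruence.compat R-cong
    }

  mutual
    eval-FmWith : ∀ {ℓ} (R : Rel Fm ℓ) v φ → eval (FmWith R) v φ ≡ subst v φ
    eval-FmWith R v (var n)   = refl
    eval-FmWith R v (op o ts) = cong (op o) (evals-FmWith R v ts)

    evals-FmWith : ∀ {ℓ} (R : Rel Fm ℓ) v {n} (ts : Vec Fm n) → evals (FmWith R) v ts ≡ evals FmAlg v ts
    evals-FmWith R v []       = refl
    evals-FmWith R v (t ∷ ts) = ≡.cong₂ _∷_ (eval-FmWith R v t) (evals-FmWith R v ts)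

  module _ (τ : Translation) where

    τ-FmWith : ∀ {ℓ ℓ'} {R : Rel Fm ℓ} {R' : Rel Fm ℓ'} → R ⇒ R' →
      τ⟨ τ ⟩ (FmWith R) ⊆ τ⟨ τ ⟩ (FmWith R')
    τ-FmWith {R = R} {R'} R⇒R' {x} x∈τ c s t st = subst₂ R' (same s) (same t) (R⇒R' (x∈τ c s t st))
      where
        same : ∀ φ → eval (FmWith R) (x ∷ₐ c) φ ≡ eval (FmWith R') (x ∷ₐ c) φ
        same φ = trans (eval-FmWith R (x ∷ₐ c) φ) (sym (eval-FmWith R' (x ∷ₐ c) φ))

  module _ {a ℓ} (A : RawAlgebra a ℓ) (isA : IsAlgebra A) where
    open RawAlgebra A
    open IsAlgebra isA
    private module ≈ = IsEquivalence isEquivalence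

    eval-isHom : ∀ w → IsHom A (eval A w)
    eval-isHom w o ts = ≈.reflexive (cong ⟦ o ⟧ (evals≡map A w ts))

    mutual
      isHom⇒≈eval : ∀ {h} → IsHom A h → ∀ φ → h φ ≈ eval A (h ∘ var) φ
      isHom⇒≈eval h-hom (var n)   = ≈.refl
      isHom⇒≈eval h-hom (op o ts) = ≈.trans (h-hom o ts) (⟦⟧-cong o (map≈evals h-hom ts))

      map≈evals : ∀ {h} → IsHom A h → ∀ {n} (ts : Vec Fm n) → Pointwise _≈_ (map h ts) (evals A (h ∘ var) ts)
      map≈evals h-hom []       = []
      map≈evals h-hom (t ∷ ts) = isHom⇒≈eval h-hom t ∷ map≈evals h-hom ts

  module _ (A : RawAlgebra 0ℓ 0ℓ) (F : Pred (RawAlgebra.Carrier A) 0ℓ) where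
    open RawAlgebra A

    Indiscernible : Rel Carrier 0ℓ
    Indiscernible u v = ∀ δ e → F (eval A (u ∷ₐ e) δ) ⇔ F (eval A (v ∷ₐ e) δ)

    Indiscernible-isEquivalence : IsEquivalence Indiscernible
    Indiscernible-isEquivalence = record
      { refl  = λ δ e → ⇔.refl
      ; sym   = λ u~v δ e → ⇔.sym (u~v δ e)
      ; trans = λ u~v v~w δ e → ⇔.trans (u~v δ e) (v~w δ e)
      }
      where module ⇔ = IsEquivalence ⇔-isEquivalence

    Indiscernible-compatible : Compatible A Indiscernible F
    Indiscernible-compatible {u} u~v = Equivalence.to (u~v (var 0) (const u))

    Indiscernible-greatest : {R : Rel Carrier 0ℓ} → Reflexive R → Symmetric R → OpCompatible A R →
      Compatible A R F → R ⇒ Indiscernible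
    Indiscernible-greatest {R} R-refl R-sym R-compat R-F uRv δ e =
      mk⇔ (R-F (lift uRv)) (R-F (lift (R-sym uRv)))
      where
        lift : ∀ {x y} → R x y → R (eval A (x ∷ₐ e) δ) (eval A (y ∷ₐ e) δ)
        lift {x} {y} xRy = eval-preserves A R-compat pointwise δ
          where
            pointwise : ∀ n → R ((x ∷ₐ e) n) ((y ∷ₐ e) n)
            pointwise zero    = xRy
            pointwise (suc k) = R-refl

    Leibniz⊆Indiscernible : Leibniz A F ⇒ Indiscernible
    Leibniz⊆Indiscernible (R , R-cong , R-F , uRv) =
      Indiscernible-greatest R-refl R-sym (IsCongruence.compat R-cong) R-F uRv
      where open IsEquivalence (IsCongruence.isEquivalence R-cong) renaming (refl to R-refl; sym to R-sym)

    Indiscernible-polynomial : ∀ {u v} → Indiscernible u v → ∀ π e →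
      Indiscernible (eval A (u ∷ₐ e) π) (eval A (v ∷ₐ e) π)
    Indiscernible-polynomial {u} {v} u~v π e δ e' =
      subst₂ (λ x y → F x ⇔ F y) (eval-plug A u e e' δ π) (eval-plug A v e e' δ π)
        (u~v (plug δ π) (interleave e e'))

    Indiscernible-opCompatible : OpCompatible A Indiscernible
    Indiscernible-opCompatible o = coordinatewise {S = Indiscernible} ~.refl ~.trans ⟦ o ⟧ step
      where
        module ~ = IsEquivalence Indiscernible-isEquivalence

        parameters : ∀ n → Vec Fm n
        parameters n = tabulate (λ i → var (suc (toℕ i)))

        eval-parameters : ∀ {n} x (zs : Vec Carrier n) f →
          map (eval A (x ∷ₐ (zs ++ₐ f))) (parameters n) ≡ zs
        eval-parameters x zs f = begin
          map (eval A (x ∷ₐ (zs ++ₐ f))) (parameters _) ≡⟨ tabulate-∘ _ _ ⟨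
          tabulate (λ i → (zs ++ₐ f) (toℕ i))            ≡⟨ tabulate-cong (++ₐ-toℕ zs f) ⟩
          tabulate (lookup zs)                            ≡⟨ tabulate∘lookup zs ⟩
          zs                                              ∎
          where open ≡.≡-Reasoning

        eval-hole : ∀ x zs f i →
          eval A (x ∷ₐ (zs ++ₐ f)) (op o (parameters (ar o) [ i ]≔ var 0)) ≡ ⟦ o ⟧ (zs [ i ]≔ x)
        eval-hole x zs f i = cong ⟦ o ⟧ (begin
          evals A w (parameters (ar o) [ i ]≔ var 0)      ≡⟨ evals≡map A w _ ⟩
          map (eval A w) (parameters (ar o) [ i ]≔ var 0) ≡⟨ map-[]≔ (eval A w) (parameters (ar o)) i ⟩
          map (eval A w) (parameters (ar o)) [ i ]≔ x     ≡⟨ cong (_[ i ]≔ x) (eval-parameters x zs f) ⟩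
          zs [ i ]≔ x                                      ∎)
          where
            open ≡.≡-Reasoning
            w = x ∷ₐ (zs ++ₐ f)

        step : ∀ zs i {u v} → Indiscernible u v → Indiscernible (⟦ o ⟧ (zs [ i ]≔ u)) (⟦ o ⟧ (zs [ i ]≔ v))
        step zs i {u} {v} u~v =
          subst₂ Indiscernible (eval-hole u zs (const u) i) (eval-hole v zs (const u) i)
            (Indiscernible-polynomial u~v (op o (parameters (ar o) [ i ]≔ var 0)) (zs ++ₐ const u))

  module _ (A : RawAlgebra 0ℓ 0ℓ) (isA : IsAlgebra A) (F : Pred (RawAlgebra.Carrier A) 0ℓ) (F-resp : Respects≈ A F) where
    open RawAlgebra A
    open IsAlgebra isA
    private module ≈ = IsEquivalence isEquivalence

    Indiscernible-isCongruence : IsCongruence A (Indiscernible A F)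
    Indiscernible-isCongruence = record
      { isEquivalence = Indiscernible-isEquivalence A F
      ; ≈⊆θ           = Indiscernible-greatest A F ≈.refl ≈.sym ⟦⟧-cong F-resp
      ; compat        = Indiscernible-opCompatible A F
      }

    Indiscernible⊆Leibniz : Indiscernible A F ⇒ Leibniz A F
    Indiscernible⊆Leibniz u~v = Indiscernible A F , Indiscernible-isCongruence , Indiscernible-compatible A F , u~v

    Kernel : (ℕ → Carrier) → Rel Fm 0ℓ
    Kernel w = _≈_ on eval A w

    Kernel⊆Leibniz : ∀ w → Kernel w ⇒ Leibniz FmAlg (F ∘ eval A w)
    Kernel⊆Leibniz w pKq = Kernel w , Kernel-isCongruence , F-resp , pKq
      where
        Kernel-isCongruence : IsCongruence FmAlg (Kernel w)
        Kernel-isCongruence = record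
          { isEquivalence = On.isEquivalence (eval A w) isEquivalence
          ; ≈⊆θ           = ≈.reflexive ∘ cong (eval A w)
          ; compat        = λ o {xs} {ys} xsKys → ⟦⟧-cong o
              (subst₂ (Pointwise _≈_) (sym (evals≡map A w xs)) (sym (evals≡map A w ys)) (Pointwise.map⁺ id xsKys))
          }

    Leibniz-preimage⇒Indiscernible : ∀ x c s t →
      (∀ e → Leibniz FmAlg (F ∘ eval A (x ∷ₐ interleave c e))
                           (subst (var 0 ∷ₐ evenVar) s) (subst (var 0 ∷ₐ evenVar) t)) →
      Indiscernible A F (eval A (x ∷ₐ c) s) (eval A (x ∷ₐ c) t)
    Leibniz-preimage⇒Indiscernible x c s t st δ e =
      subst₂ (λ y z → F y ⇔ F z) (eval-plug A x c e δ s) (eval-plug A x c e δ t)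
        (Leibniz⊆Indiscernible FmAlg _ (st e) δ oddVar)

  module _ (L : Logic) where

    preimage-isTheory : ∀ (A : RawAlgebra 0ℓ 0ℓ) → IsAlgebra A → ∀ {F} → IsFilter L A F →
      ∀ w → IsTheory L (F ∘ eval A w)
    preimage-isTheory A isA F-filter w Γ φ Γ⊢φ h h-hom = F-filter Γ φ Γ⊢φ (eval A w ∘ h) w∘h-hom
      where
        open RawAlgebra A
        open IsEquivalence (IsAlgebra.isEquivalence isA) using (reflexive)
        w∘h-hom : IsHom A (eval A w ∘ h)
        w∘h-hom o ts = reflexive (begin
          eval A w (h (op o ts))             ≡⟨ cong (eval A w) (h-hom o ts) ⟩
          ⟦ o ⟧ (evals A w (map h ts))       ≡⟨ cong ⟦ o ⟧ (evals≡map A w (map h ts)) ⟩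
          ⟦ o ⟧ (map (eval A w) (map h ts))  ≡⟨ cong ⟦ o ⟧ (map-∘ (eval A w) h ts) ⟨
          ⟦ o ⟧ (map (eval A w ∘ h) ts)      ∎)
          where open ≡.≡-Reasoning

    FmWith-isFilter : ∀ {Γ} {R : Rel Fm 0ℓ} → IsTheory L Γ → IsCongruence FmAlg R → Compatible FmAlg R Γ →
      IsFilter L (FmWith R) Γ
    FmWith-isFilter {Γ} {R} Γ-theory R-cong R-Γ Δ φ Δ⊢φ h h-hom h[Δ]⊆Γ =
      R-Γ (R-sym (h≈subst φ)) (Γ-theory Δ φ Δ⊢φ (subst σ) (eval-isHom FmAlg FmAlg-isAlgebra σ) σ[Δ]⊆Γ)
      where
        open IsEquivalence (IsCongruence.isEquivalence R-cong) renaming (sym to R-sym)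
        σ = h ∘ var
        h≈subst : ∀ φ → R (h φ) (subst σ φ)
        h≈subst φ = ≡.subst (R (h φ)) (eval-FmWith R σ φ) (isHom⇒≈eval (FmWith R) (FmWith-isAlgebra R-cong) h-hom φ)
        σ[Δ]⊆Γ : ∀ ψ → Δ ψ → Γ (subst σ ψ)
        σ[Δ]⊆Γ ψ ψ∈Δ = R-Γ (h≈subst ψ) (h[Δ]⊆Γ ψ ψ∈Δ)

    module _ (τ : Translation) where

      Mod*⇒LMod* : AlmostDefinesMod* L τ → AlmostDefinesLMod* L τ
      Mod*⇒LMod* Mod*-defined Γ Γ-theory Γ-nonempty x =
        proj₁ (τ≡Γ x) ∘ τ-FmWith τ {R = Leibniz FmAlg Γ} (Leibniz⊆Indiscernible FmAlg Γ) ,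
        τ-FmWith τ {R' = Leibniz FmAlg Γ} (Indiscernible⊆Leibniz FmAlg FmAlg-isAlgebra Γ Γ-resp) ∘ proj₂ (τ≡Γ x)
        where
          Γ-resp : Respects≈ FmAlg Γ
          Γ-resp = ≡.subst Γ

          θ-cong : IsCongruence FmAlg (Indiscernible FmAlg Γ)
          θ-cong = Indiscernible-isCongruence FmAlg FmAlg-isAlgebra Γ Γ-resp

          -- Maximality of Indiscernible FmAlg Γ only involves the operations,
          -- which FmWith shares with FmAlg.
          reduced : Reduced (FmWith (Indiscernible FmAlg Γ)) Γ
          reduced (R , R-cong , R-Γ , pRq) = Indiscernible-greatest FmAlg Γ R-refl R-sym (IsCongruence.compat R-cong) R-Γ pRq
            where open IsEquivalence (IsCongruence.isEquivalence R-cong) renaming (refl to R-refl; sym to R-sym)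

          -- ⟨𝐅𝐦/ΩΓ, Γ⟩ itself: FmQuot Γ lives one universe level too high to be
          -- an algebra of Mod*, FmWith (Indiscernible FmAlg Γ) is the same matrix.
          τ≡Γ : SameSet (τ⟨ τ ⟩ (FmWith (Indiscernible FmAlg Γ))) Γ
          τ≡Γ = Mod*-defined (FmWith (Indiscernible FmAlg Γ)) (FmWith-isAlgebra θ-cong) Γ
                  (Indiscernible-compatible FmAlg Γ)
                  (FmWith-isFilter Γ-theory θ-cong (Indiscernible-compatible FmAlg Γ))
                  reduced Γ-nonempty

      LMod*⇒Mod* : AlmostDefinesLMod* L τ → AlmostDefinesMod* L τ
      LMod*⇒Mod* LMod*-defined A isA F F-resp F-filter F-reduced (b , b∈F) x = τ⊆F x , F⊆τ x
        where
          open RawAlgebra A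

          LMod*-preimage : ∀ w → Σ Fm (F ∘ eval A w) → SameSet (τ⟨ τ ⟩ (FmQuot (F ∘ eval A w))) (F ∘ eval A w)
          LMod*-preimage w = LMod*-defined (F ∘ eval A w) (preimage-isTheory A isA {F} F-filter w)

          eval-instance : ∀ {ℓ} (R : Rel Fm ℓ) w c φ →
            eval A w (eval (FmWith R) (var 0 ∷ₐ c) φ) ≡ eval A (w 0 ∷ₐ (eval A w ∘ c)) φ
          eval-instance R w c φ =
            trans (cong (eval A w) (eval-FmWith R (var 0 ∷ₐ c) φ)) (eval-subst-∷ₐ A (var 0) (λ _ → refl) φ)

          τ⊆F : ∀ a → τ⟨ τ ⟩ A a → F a
          τ⊆F a a∈τ = proj₁ (LMod*-preimage w (var 1 , b∈F) (var 0)) var₀∈τ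
            where
              w = a ∷ₐ const b
              var₀∈τ : τ⟨ τ ⟩ (FmQuot (F ∘ eval A w)) (var 0)
              var₀∈τ c s t st = Kernel⊆Leibniz A isA F F-resp w
                (subst₂ _≈_ (sym (eval-instance _ w c s)) (sym (eval-instance _ w c t)) (a∈τ (eval A w ∘ c) s t st))

          F⊆τ : ∀ a → F a → τ⟨ τ ⟩ A a
          F⊆τ a a∈F c s t st = F-reduced (Indiscernible⊆Leibniz A isA F F-resp
            (Leibniz-preimage⇒Indiscernible A isA F F-resp a c s t λ e →
              let w = a ∷ₐ interleave c e
                  var₀∈τ = proj₂ (LMod*-preimage w (var 0 , a∈F) (var 0)) a∈F
              in subst₂ (Leibniz FmAlg (F ∘ eval A w)) (eval-FmWith _ _ s) (eval-FmWith _ _ t) (var₀∈τ evenVar s t st)))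

lemma3p7 : (sig : Signature) → (L : AAL.Logic sig) → (τ : AAL.Translation sig) → AAL.AlmostDefinesMod* sig L τ ⇔ AAL.AlmostDefinesLMod* sig L τ
lemma3p7 sig L τ = mk⇔ (Mod*⇒LMod* L τ) (LMod*⇒Mod* L τ)
  where open AlmostDefinability sig
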